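{- Let $G$ be a graph, let $\mathsf{w}$ be a normal weighting of $G$, and let $u,v\in V(G)$ be distinct vertices such that $N(u)\subseteq N[v]$. Let $G' := G-u$ and let $\mathsf{w}'$ be the weighting of $G'$ defined by $\mathsf{w}'(v) := \mathsf{w}(u)+\mathsf{w}(v)$ and $\mathsf{w}'(x) := \mathsf{w}(x)$ for $x\neq v$. Then every $\mathsf{w}'$-balanced separator $S$ of $G'$ with $v\notin S$ is a $\mathsf{w}$-balanced separator of $G$.
   Context: All graphs are finite and simple. A weighting is a function $\mathsf{w}\colon V(G)\to\mathbb{R}_{\geq0}$, normal if $\mathsf{w}(V(G))=1$; $\mathsf{w}(A)=\sum_{x\in A}\mathsf{w}(x)$. A subgraph $H$ is heavy if $\mathsf{w}(H) > \frac12\mathsf{w}(V(G))$. A set $S\subseteq V(G)$ is a $\mathsf{w}$-balanced separator of $G$ if no component of $G-S$ is heavy. $N(u)$ is the open and $N[v]$ the closed neighbourhood. -}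

module Defs where

open import Level using (Level; _⊔_) renaming (suc to lsuc)
open import Data.Nat using (ℕ; zero; suc)
open import Data.Fin using (Fin; zero; suc; _≟_)
open import Data.Fin.Subset using (Subset; _∈_; _∉_; _⊆_; _─_; ⊤; ∁; ⁅_⁆)
open import Data.Fin.Subset.Properties using (_∈?_)
open import Data.Product using (_×_; ∃-syntax)
open import Data.Sum using (_⊎_)
open import Data.Bool using (if_then_else_)
open import Relation.Nullary using (¬_; does)
open import Relation.Binary using (Rel; IsStrictTotalOrder)
open import Relation.Binary.PropositionalEquality using (_≡_)
open import Algebra.Bundles using (CommutativeRing)

-- A totally ordered commutative ring in which 2 is invertible
-- (half + half ≈ 1).  The real numbers are an instance; weights are
-- taken in an arbitrary such structure (stdlib has no ℝ).
record OrderedRingHalf (c ℓ : Level) : Set (lsuc (c ⊔ ℓ)) where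
  field
    commutativeRing : CommutativeRing c ℓ
  open CommutativeRing commutativeRing public
  field
    _<_                : Rel Carrier ℓ
    isStrictTotalOrder : IsStrictTotalOrder _≈_ _<_
    +-mono-<           : ∀ {x y} z → x < y → (x + z) < (y + z)
    *-pos              : ∀ {x y} → 0# < x → 0# < y → 0# < (x * y)
    half               : Carrier
    half+half          : (half + half) ≈ 1#

  _≤_ : Rel Carrier ℓ
  x ≤ y = x < y ⊎ x ≈ y

record Graph (n : ℕ) : Set₁ where
  field
    Adj        : Fin n → Fin n → Set
    Adj-sym    : ∀ {x y} → Adj x y → Adj y x
    Adj-irrefl : ∀ {x} → ¬ Adj x x
open Graph public

data PathIn {n : ℕ} (G : Graph n) (A : Subset n) : Fin n → Fin n → Set where
  here : ∀ {x} → x ∈ A → PathIn G A x x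
  step : ∀ {x y z} → x ∈ A → Adj G x y → PathIn G A y z → PathIn G A x z

-- C is (the vertex set of) a connected component of G[A]:
-- nonempty, contained in A, connected in G[A], and closed under
-- adjacency inside A (i.e. maximal connected).
record IsComponent {n : ℕ} (G : Graph n) (A C : Subset n) : Set where
  field
    sub       : C ⊆ A
    nonempty  : ∃[ x ] x ∈ C
    connected : ∀ {x y} → x ∈ C → y ∈ C → PathIn G A x y
    closed    : ∀ {x y} → x ∈ C → y ∈ A → Adj G x y → y ∈ C

module _ {c ℓ : Level} (R : OrderedRingHalf c ℓ) where
  open OrderedRingHalf R using (Carrier; _≈_; _+_; _*_; 0#; 1#; _<_; _≤_; half)

  Weighting : ℕ → Set c
  Weighting n = Fin n → Carrier

  sumFin : ∀ {n} → (Fin n → Carrier) → Carrier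
  sumFin {zero}  f = 0#
  sumFin {suc n} f = f zero + sumFin (λ i → f (suc i))

  weight : ∀ {n} → Weighting n → Subset n → Carrier
  weight w A = sumFin (λ x → if does (x ∈? A) then w x else 0#)

  NonNegative : ∀ {n} → Weighting n → Set ℓ
  NonNegative w = ∀ x → 0# ≤ w x

  Normal : ∀ {n} → Weighting n → Set ℓ
  Normal w = weight w ⊤ ≈ 1#

  Heavy : ∀ {n} → Subset n → Weighting n → Subset n → Set ℓ
  Heavy D w C = (half * weight w D) < weight w C

  BalancedSep : ∀ {n} → Graph n → Subset n → Weighting n → Subset n → Set ℓ
  BalancedSep G D w S =
    S ⊆ D × (∀ C → IsComponent G (D ─ S) C → ¬ Heavy D w C)

  merge : ∀ {n} → Weighting n → Fin n → Fin n → Weighting n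
  merge w u v x = if does (x ≟ v) then w u + w v else w x

{-# OPTIONS --safe #-}
module Submission where

-- Let G′ = G − u.  A component C of G − S avoiding u is a component of
-- G′ − S, and w(C) ≤ w′(C).  If u ∈ C then, since every neighbour of u is v
-- or a neighbour of v, every other vertex of C is joined to v by a walk in
-- G′ − S; hence C ⊆ {u} ∪ D for the component D of v in G′ − S, and
-- w(C) ≤ w(u) + w(D) = w′(D).  As w′(V(G′)) = w(V(G)), a heavy component of
-- G − S would give a heavy component of G′ − S.

open import Defs
open import Level using (Level)
open import Function using (_∘_)
open import Data.Nat using (ℕ)
open import Data.Fin using (Fin; zero; suc; _≟_)
open import Data.Fin.Subset
  using (Subset; _∈_; _∉_; _⊆_; _─_; _-_; _∪_; ⊥; ⊤; ∁; ⁅_⁆; inside; outside)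
open import Data.Fin.Subset.Properties
  using (_∈?_; ∈⊤; ⊆⊤; x∈⁅x⁆; x≢y⇒x∉⁅y⁆; x∈∁p⇒x∉p; x∉p⇒x∈∁p; drop-there; drop-∷-⊆;
         x∈p∪q⁺; p∪∁p≡⊤; ∪-identityˡ; p─q─r≡p─r─q)
open import Data.Vec using (_∷_; []; tabulate; here; there)
open import Data.Product using (_×_; _,_; proj₁; proj₂; ∃-syntax)
open import Data.Sum using (_⊎_; inj₁; inj₂)
open import Data.Bool using (if_then_else_)
open import Relation.Nullary using (¬_; yes; no; does; contradiction; ¬¬-excluded-middle)
open import Relation.Unary using (Pred; Decidable)
open import Relation.Binary.PropositionalEquality using (_≡_; _≢_)
import Relation.Binary.PropositionalEquality as ≡
open import Relation.Binary.Bundles using (StrictPartialOrder)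
open import Relation.Binary.Structures using (IsStrictTotalOrder)

x∈p─q⁺ : ∀ {n} {p q : Subset n} {x} → x ∈ p → x ∉ q → x ∈ p ─ q
x∈p─q⁺ {q = inside ∷ q}  here        x∉q = contradiction here x∉q
x∈p─q⁺ {q = outside ∷ q} here        _   = here
x∈p─q⁺ {q = _ ∷ q}       (there x∈p) x∉q = there (x∈p─q⁺ x∈p (x∉q ∘ there))

x∈p─q⁻ : ∀ {n} (p q : Subset n) {x} → x ∈ p ─ q → x ∈ p × x ∉ q
x∈p─q⁻ (inside ∷ p)  (outside ∷ q) here          = here , λ ()
x∈p─q⁻ (outside ∷ p) (outside ∷ q) {zero} ()
x∈p─q⁻ (_ ∷ p)       (inside ∷ q)  {zero} ()
x∈p─q⁻ (_ ∷ p)       (_ ∷ q)       (there x∈p─q) with x∈p─q⁻ p q x∈p─q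
... | x∈p , x∉q = there x∈p , x∉q ∘ drop-there

x∈p-y⁺ : ∀ {n} {p : Subset n} {x y} → x ∈ p → x ≢ y → x ∈ p - y
x∈p-y⁺ x∈p x≢y = x∈p─q⁺ x∈p (x≢y⇒x∉⁅y⁆ x≢y)

p-y⊆p : ∀ {n} {p : Subset n} {y} → p - y ⊆ p
p-y⊆p {p = p} {y} = proj₁ ∘ x∈p─q⁻ p ⁅ y ⁆

y∉p-y : ∀ {n} {p : Subset n} {y} → y ∉ p - y
y∉p-y {p = p} {y} y∈p-y = proj₂ (x∈p─q⁻ p ⁅ y ⁆ y∈p-y) (x∈⁅x⁆ y)

⊤─p≡∁p : ∀ {n} (p : Subset n) → ⊤ ─ p ≡ ∁ p
⊤─p≡∁p []            = ≡.refl
⊤─p≡∁p (inside ∷ p)  = ≡.cong (outside ∷_) (⊤─p≡∁p p)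
⊤─p≡∁p (outside ∷ p) = ≡.cong (inside ∷_) (⊤─p≡∁p p)

⊤─q-y≡∁⁅y⁆─q : ∀ {n} (q : Subset n) y → ⊤ ─ q - y ≡ ∁ ⁅ y ⁆ ─ q
⊤─q-y≡∁⁅y⁆─q q y = ≡.trans (p─q─r≡p─r─q ⊤ q ⁅ y ⁆) (≡.cong (_─ q) (⊤─p≡∁p ⁅ y ⁆))

subsetOf : ∀ {n p} {P : Pred (Fin n) p} → Decidable P → Subset n
subsetOf P? = tabulate (does ∘ P?)

∈-subsetOf⁺ : ∀ {n p} {P : Pred (Fin n) p} (P? : Decidable P) {x} → P x → x ∈ subsetOf P?
∈-subsetOf⁺ P? {zero} Px with P? zero
... | yes _  = here
... | no ¬Px = contradiction Px ¬Px
∈-subsetOf⁺ P? {suc x} Px = there (∈-subsetOf⁺ (P? ∘ suc) Px)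

∈-subsetOf⁻ : ∀ {n p} {P : Pred (Fin n) p} (P? : Decidable P) {x} → x ∈ subsetOf P? → P x
∈-subsetOf⁻ P? {zero} x∈P with P? zero
... | yes Px = Px
∈-subsetOf⁻ P? {suc x} (there x∈P) = ∈-subsetOf⁻ (P? ∘ suc) x∈P

¬¬-decidable : ∀ {n p} (P : Pred (Fin n) p) → ¬ ¬ Decidable P
¬¬-decidable {ℕ.zero}  P ¬P? = ¬P? λ ()
¬¬-decidable {ℕ.suc n} P ¬P? = ¬¬-excluded-middle λ P0? → ¬¬-decidable (P ∘ suc) λ P∘suc? →
  ¬P? λ { zero → P0? ; (suc x) → P∘suc? x }

module OrderedRingHalfProperties {c ℓ : Level} (R : OrderedRingHalf c ℓ) where
  open OrderedRingHalf R hiding (zero)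

  strictPartialOrder : StrictPartialOrder c ℓ ℓ
  strictPartialOrder = record
    { isStrictPartialOrder = IsStrictTotalOrder.isStrictPartialOrder isStrictTotalOrder }

  open import Relation.Binary.Reasoning.StrictPartialOrder strictPartialOrder public

  ≤-refl : ∀ {x} → x ≤ x
  ≤-refl = inj₂ refl

  +-monoˡ-≤ : ∀ {x y} z → x ≤ y → (x + z) ≤ (y + z)
  +-monoˡ-≤ z (inj₁ x<y) = inj₁ (+-mono-< z x<y)
  +-monoˡ-≤ z (inj₂ x≈y) = inj₂ (+-congʳ x≈y)

  +-monoʳ-≤ : ∀ {x y} z → x ≤ y → (z + x) ≤ (z + y)
  +-monoʳ-≤ {x} {y} z x≤y = begin
    z + x  ≈⟨ +-comm z x ⟩
    x + z  ≤⟨ +-monoˡ-≤ z x≤y ⟩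
    y + z  ≈⟨ +-comm y z ⟩
    z + y  ∎

  +-mono-≤ : ∀ {x y u v} → x ≤ y → u ≤ v → (x + u) ≤ (y + v)
  +-mono-≤ {x} {y} {u} {v} x≤y u≤v = begin
    x + u  ≤⟨ +-monoˡ-≤ u x≤y ⟩
    y + u  ≤⟨ +-monoʳ-≤ y u≤v ⟩
    y + v  ∎

  x≤y+x : ∀ {x y} → 0# ≤ y → x ≤ (y + x)
  x≤y+x {x} {y} 0≤y = begin
    x       ≈⟨ +-identityˡ x ⟨
    0# + x  ≤⟨ +-monoˡ-≤ x 0≤y ⟩
    y + x   ∎

module WeightProperties {c ℓ : Level} (R : OrderedRingHalf c ℓ) where
  open OrderedRingHalf R hiding (zero)
  open OrderedRingHalfProperties R
  open import Algebra.Properties.CommutativeSemigroup +-commutativeSemigroup using (x∙yz≈y∙xz)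

  -- merge R w u v unfolds to addAt w v (w u); allowing an arbitrary increment a
  -- is what lets weight-addAt go through by induction.
  addAt : ∀ {n} → Weighting R n → Fin n → Carrier → Weighting R n
  addAt w v a x = if does (x ≟ v) then a + w v else w x

  w≤addAt : ∀ {n} (w : Weighting R n) v {a} → 0# ≤ a → ∀ x → w x ≤ addAt w v a x
  w≤addAt w v 0≤a x with x ≟ v
  ... | yes ≡.refl = x≤y+x 0≤a
  ... | no _       = ≤-refl

  weight-monoˡ : ∀ {n} {w w′ : Weighting R n} → (∀ x → w x ≤ w′ x) →
                 ∀ D → weight R w D ≤ weight R w′ D
  weight-monoˡ w≤w′ []            = ≤-refl
  weight-monoˡ w≤w′ (inside ∷ D)  = +-mono-≤ (w≤w′ zero) (weight-monoˡ (w≤w′ ∘ suc) D)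
  weight-monoˡ w≤w′ (outside ∷ D) = +-monoʳ-≤ 0# (weight-monoˡ (w≤w′ ∘ suc) D)

  weight-monoʳ : ∀ {n} {w : Weighting R n} {C D} → NonNegative R w → C ⊆ D →
                 weight R w C ≤ weight R w D
  weight-monoʳ {C = []}          {[]}          _   _   = ≤-refl
  weight-monoʳ {C = inside ∷ C}  {inside ∷ D}  w≥0 C⊆D =
    +-monoʳ-≤ _ (weight-monoʳ (w≥0 ∘ suc) (drop-∷-⊆ C⊆D))
  weight-monoʳ {C = inside ∷ C}  {outside ∷ D} _   C⊆D = contradiction (C⊆D here) λ ()
  weight-monoʳ {C = outside ∷ C} {inside ∷ D}  w≥0 C⊆D =
    +-mono-≤ (w≥0 zero) (weight-monoʳ (w≥0 ∘ suc) (drop-∷-⊆ C⊆D))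
  weight-monoʳ {C = outside ∷ C} {outside ∷ D} w≥0 C⊆D =
    +-monoʳ-≤ 0# (weight-monoʳ (w≥0 ∘ suc) (drop-∷-⊆ C⊆D))

  weight-insert : ∀ {n} (w : Weighting R n) {u D} → u ∉ D →
                  weight R w (⁅ u ⁆ ∪ D) ≈ w u + weight R w D
  weight-insert w {zero}  {inside ∷ D}  u∉D = contradiction here u∉D
  weight-insert w {zero}  {outside ∷ D} _   = +-congˡ (begin-equality
    weight R (w ∘ suc) (⊥ ∪ D)        ≡⟨ ≡.cong (weight R (w ∘ suc)) (∪-identityˡ D) ⟩
    weight R (w ∘ suc) D              ≈⟨ +-identityˡ _ ⟨
    0# + weight R (w ∘ suc) D         ∎)
  weight-insert w {suc u} {inside ∷ D}  u∉D =
    trans (+-congˡ (weight-insert (w ∘ suc) (u∉D ∘ there))) (x∙yz≈y∙xz _ _ _)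
  weight-insert w {suc u} {outside ∷ D} u∉D =
    trans (+-congˡ (weight-insert (w ∘ suc) (u∉D ∘ there))) (x∙yz≈y∙xz _ _ _)

  weight-addAt : ∀ {n} (w : Weighting R n) a {v D} → v ∈ D →
                 weight R (addAt w v a) D ≈ a + weight R w D
  weight-addAt w a {zero}  here        = +-assoc a (w zero) _
  weight-addAt w a {suc v} (there v∈D) =
    trans (+-congˡ (weight-addAt (w ∘ suc) a v∈D)) (x∙yz≈y∙xz _ _ _)

  weight-merge-total : ∀ {n} (w : Weighting R n) {u v} → u ≢ v →
                       weight R (merge R w u v) (∁ ⁅ u ⁆) ≈ weight R w ⊤
  weight-merge-total w {u} {v} u≢v = begin-equality
    weight R (merge R w u v) (∁ ⁅ u ⁆)  ≈⟨ weight-addAt w (w u) v∈∁⁅u⁆ ⟩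
    w u + weight R w (∁ ⁅ u ⁆)          ≈⟨ weight-insert w u∉∁⁅u⁆ ⟨
    weight R w (⁅ u ⁆ ∪ ∁ ⁅ u ⁆)        ≡⟨ ≡.cong (weight R w) (p∪∁p≡⊤ ⁅ u ⁆) ⟩
    weight R w ⊤                        ∎
    where
    v∈∁⁅u⁆ : v ∈ ∁ ⁅ u ⁆
    v∈∁⁅u⁆ = x∉p⇒x∈∁p (x≢y⇒x∉⁅y⁆ (u≢v ∘ ≡.sym))
    u∉∁⁅u⁆ : u ∉ ∁ ⁅ u ⁆
    u∉∁⁅u⁆ u∈∁⁅u⁆ = x∈∁p⇒x∉p u∈∁⁅u⁆ (x∈⁅x⁆ u)

  weight-≤-merge : ∀ {n} {w : Weighting R n} {u v} → NonNegative R w →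
                   ∀ C → weight R w C ≤ weight R (merge R w u v) C
  weight-≤-merge {w = w} {u} {v} w≥0 = weight-monoˡ (w≤addAt w v (w≥0 u))

  weight-≤-merge-⁅u⁆∪ : ∀ {n} {w : Weighting R n} {u v C D} → NonNegative R w →
                        u ∉ D → v ∈ D → C ⊆ ⁅ u ⁆ ∪ D →
                        weight R w C ≤ weight R (merge R w u v) D
  weight-≤-merge-⁅u⁆∪ {w = w} {u} {v} {C} {D} w≥0 u∉D v∈D C⊆⁅u⁆∪D = begin
    weight R w C                 ≤⟨ weight-monoʳ w≥0 C⊆⁅u⁆∪D ⟩
    weight R w (⁅ u ⁆ ∪ D)       ≈⟨ weight-insert w u∉D ⟩
    w u + weight R w D           ≈⟨ weight-addAt w (w u) v∈D ⟨
    weight R (merge R w u v) D   ∎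

  Heavy-mono : ∀ {n} {w w′ : Weighting R n} {D D′ C C′} →
               weight R w′ D′ ≈ weight R w D → weight R w C ≤ weight R w′ C′ →
               Heavy R D w C → Heavy R D′ w′ C′
  Heavy-mono {w = w} {w′} {D} {D′} {C} {C′} D′≈D C≤C′ C-heavy = begin-strict
    half * weight R w′ D′  ≈⟨ *-congˡ D′≈D ⟩
    half * weight R w D    <⟨ C-heavy ⟩
    weight R w C           ≤⟨ C≤C′ ⟩
    weight R w′ C′         ∎

module Walks {n : ℕ} (G : Graph n) where

  walk-start : ∀ {A x y} → PathIn G A x y → x ∈ A
  walk-start (here x∈A)     = x∈A
  walk-start (step x∈A _ _) = x∈A

  walk-end : ∀ {A x y} → PathIn G A x y → y ∈ A
  walk-end (here y∈A)     = y∈A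
  walk-end (step _ _ x⇝y) = walk-end x⇝y

  walk-mono : ∀ {A B x y} → A ⊆ B → PathIn G A x y → PathIn G B x y
  walk-mono A⊆B (here x∈A)         = here (A⊆B x∈A)
  walk-mono A⊆B (step x∈A x~y y⇝z) = step (A⊆B x∈A) x~y (walk-mono A⊆B y⇝z)

  walk-++ : ∀ {A x y z} → PathIn G A x y → PathIn G A y z → PathIn G A x z
  walk-++ (here _)           y⇝z = y⇝z
  walk-++ (step x∈A x~y y⇝z) z⇝t = step x∈A x~y (walk-++ y⇝z z⇝t)

  walk-snoc : ∀ {A x y z} → PathIn G A x y → Adj G y z → z ∈ A → PathIn G A x z
  walk-snoc x⇝y y~z z∈A = walk-++ x⇝y (step (walk-end x⇝y) y~z (here z∈A))

  walk-reverse : ∀ {A x y} → PathIn G A x y → PathIn G A y x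
  walk-reverse (here x∈A)         = here x∈A
  walk-reverse (step x∈A x~y y⇝z) = walk-snoc (walk-reverse y⇝z) (Adj-sym G x~y) x∈A

  walk-within : ∀ {A C x y} → IsComponent G A C → x ∈ C → PathIn G A x y → PathIn G C x y
  walk-within C-comp x∈C (here _)         = here x∈C
  walk-within C-comp x∈C (step _ x~y y⇝z) =
    step x∈C x~y (walk-within C-comp (IsComponent.closed C-comp x∈C (walk-start y⇝z) x~y) y⇝z)

module Components {n : ℕ} (G : Graph n) where
  open Walks G
  open IsComponent

  component-restrict : ∀ {A B C} → IsComponent G A C → C ⊆ B → B ⊆ A → IsComponent G B C
  component-restrict C-comp C⊆B B⊆A = record
    { sub       = C⊆B
    ; nonempty  = nonempty C-comp
    ; connected = λ x∈C y∈C → walk-mono C⊆B (walk-within C-comp x∈C (connected C-comp x∈C y∈C))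
    ; closed    = λ x∈C y∈B → closed C-comp x∈C (B⊆A y∈B)
    }

  reachable-component : ∀ {A x} (reach? : Decidable (PathIn G A x)) → x ∈ A →
                        IsComponent G A (subsetOf reach?)
  reachable-component {A} {x} reach? x∈A = record
    { sub       = walk-end ∘ reached
    ; nonempty  = x , ∈-subsetOf⁺ reach? (here x∈A)
    ; connected = λ y∈C z∈C → walk-++ (walk-reverse (reached y∈C)) (reached z∈C)
    ; closed    = λ y∈C z∈A y~z → ∈-subsetOf⁺ reach? (walk-snoc (reached y∈C) y~z z∈A)
    }
    where
    reached : ∀ {y} → y ∈ subsetOf reach? → PathIn G A x y
    reached = ∈-subsetOf⁻ reach?

  -- Adjacency is an arbitrary relation, so reachability need not be decidable;
  -- the component of a vertex therefore exists only up to double negation,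
  -- which suffices because being a balanced separator is a negative statement.
  ¬¬-component : ∀ {A x} → x ∈ A → ¬ ¬ (∃[ C ] IsComponent G A C × x ∈ C)
  ¬¬-component {A} {x} x∈A ¬C = ¬¬-decidable (PathIn G A x) λ reach? →
    ¬C (subsetOf reach? , reachable-component reach? x∈A , ∈-subsetOf⁺ reach? (here x∈A))

  Dominates : Fin n → Fin n → Set
  Dominates v u = ∀ x → Adj G u x → x ≡ v ⊎ Adj G v x

  walk-to-neighbour : ∀ {A x u} → PathIn G A x u → x ≢ u →
                      ∃[ a ] PathIn G (A - u) x a × Adj G a u
  walk-to-neighbour (here _) x≢u = contradiction ≡.refl x≢u
  walk-to-neighbour {u = u} (step {y = y} x∈A x~y y⇝u) x≢u with y ≟ u
  ... | yes ≡.refl = _ , here (x∈p-y⁺ x∈A x≢u) , x~y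
  ... | no y≢u     with walk-to-neighbour y⇝u y≢u
  ...   | a , y⇝a , a~u = a , step (x∈p-y⁺ x∈A x≢u) x~y y⇝a , a~u

  walk-from-dominator : ∀ {A u v x} → Dominates v u → v ∈ A - u →
                        PathIn G A x u → x ≢ u → PathIn G (A - u) v x
  walk-from-dominator v≽u v∈A-u x⇝u x≢u with walk-to-neighbour x⇝u x≢u
  ... | a , x⇝a , a~u with v≽u a (Adj-sym G a~u)
  ...   | inj₁ ≡.refl = walk-reverse x⇝a
  ...   | inj₂ v~a    = step v∈A-u v~a (walk-reverse x⇝a)

  component-⊆-⁅u⁆∪ : ∀ {A C D u v} → Dominates v u → IsComponent G A C → u ∈ C →
                     IsComponent G (A - u) D → v ∈ D → C ⊆ ⁅ u ⁆ ∪ D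
  component-⊆-⁅u⁆∪ {A} {u = u} {v} v≽u C-comp u∈C D-comp v∈D {x} x∈C with x ≟ u
  ... | yes ≡.refl = x∈p∪q⁺ (inj₁ (x∈⁅x⁆ u))
  ... | no x≢u     = x∈p∪q⁺ (inj₂ (walk-end (walk-within D-comp v∈D v⇝x)))
    where
    v⇝x : PathIn G (A - u) v x
    v⇝x = walk-from-dominator v≽u (sub D-comp v∈D) (connected C-comp x∈C u∈C) x≢u

module _ {c ℓ : Level} (R : OrderedRingHalf c ℓ) {n : ℕ} (G : Graph n) where
  open OrderedRingHalf R using (_≤_)
  open WeightProperties R
  open Components G

  component-outweighed :
    ∀ {w : Weighting R n} {u v A C} → NonNegative R w → u ≢ v → Dominates v u → v ∈ A →
    IsComponent G A C →
    ¬ ¬ (∃[ C′ ] IsComponent G (A - u) C′ × weight R w C ≤ weight R (merge R w u v) C′)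
  component-outweighed {u = u} {v} {A} {C} w≥0 u≢v v≽u v∈A C-comp with u ∈? C
  ... | no u∉C = λ ¬C′ →
    ¬C′ (C , component-restrict C-comp C⊆A-u p-y⊆p , weight-≤-merge w≥0 C)
    where
    C⊆A-u : C ⊆ A - u
    C⊆A-u x∈C = x∈p-y⁺ (IsComponent.sub C-comp x∈C) λ { ≡.refl → u∉C x∈C }
  ... | yes u∈C = λ ¬C′ → ¬¬-component v∈A-u λ (D , D-comp , v∈D) →
    ¬C′ (D , D-comp , weight-≤-merge-⁅u⁆∪ w≥0 (y∉p-y ∘ IsComponent.sub D-comp) v∈D
                        (component-⊆-⁅u⁆∪ v≽u C-comp u∈C D-comp v∈D))
    where
    v∈A-u : v ∈ A - u
    v∈A-u = x∈p-y⁺ v∈A (u≢v ∘ ≡.sym)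

open WeightProperties using (weight-merge-total; Heavy-mono)

lemma4p8 : ∀ {c ℓ} (R : OrderedRingHalf c ℓ) {n} (G : Graph n)
    (w : Weighting R n) → NonNegative R w → Normal R w →
    (u v : Fin n) → u ≢ v →
    (∀ x → Adj G u x → x ≡ v ⊎ Adj G v x) →
    (S : Subset n) → v ∉ S →
    BalancedSep R G (∁ ⁅ u ⁆) (merge R w u v) S →
    BalancedSep R G ⊤ w S
lemma4p8 R G w w≥0 _ u v u≢v v≽u S v∉S (_ , balanced) = ⊆⊤ , λ C C-comp C-heavy →
  component-outweighed R G w≥0 u≢v v≽u (x∈p─q⁺ ∈⊤ v∉S) C-comp λ (C′ , C′-comp , C≤C′) →
    balanced C′ (≡.subst (λ B → IsComponent G B C′) (⊤─q-y≡∁⁅y⁆─q S u) C′-comp)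
      (Heavy-mono R {D = ⊤} {∁ ⁅ u ⁆} {C} {C′} (weight-merge-total R w u≢v) C≤C′ C-heavy)
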